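{- Let $A$ be a totally ordered alphabet, let $u,v$ be nonempty finite words over $A$ with $u^\omega<v^\omega$, and let $x,y$ be finite words. Then: (i) if neither of $u,v$ is a prefix of the other, then $(ux)^\omega<(vy)^\omega$; (ii) if $v$ is not a fractional power of $u$, then $(u^{k+1}x)^\omega<(vy)^\omega$, where $k$ is the largest integer such that $u^k$ is a prefix of $v$. In particular $u^\omega<(vy)^\omega$.
   Context: The order $<$ on finite and infinite words is the lexicographical order induced by the order of $A$: $s<t$ if either $s$ is a proper prefix of $t$, or $s=pas'$, $t=pbt'$ with $p$ a finite word, $a,b$ letters with $a<b$. For a nonempty finite word $w$, $w^\omega=www\cdots$. A word $v$ is a fractional power of $u$ if $u=u_1u_2$ and $v=u^ku_1$ for some words $u_1,u_2$ and integer $k\ge0$. -}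

module Defs where

open import Level using (Level)
open import Data.Nat using (ℕ; zero; suc; _<_)
open import Data.Nat.DivMod using (_mod_)
open import Data.List using (List; []; _∷_; _++_; length; lookup; concat; replicate)
open import Data.List.NonEmpty using (List⁺; toList)
open import Data.Product using (Σ; ∃; _×_)
open import Relation.Binary.PropositionalEquality using (_≡_)

private variable a ℓ : Level

_^_ : {A : Set a} → List A → ℕ → List A
u ^ k = concat (replicate k u)

IsPrefix : {A : Set a} → List A → List A → Set a
IsPrefix p w = ∃ λ s → p ++ s ≡ w

_^ω : {A : Set a} → List⁺ A → ℕ → A
(w ^ω) i = lookup (toList w) (i mod length (toList w))

-- lexicographic order on infinite words induced by _<_ on letters
-- (the "proper prefix" clause cannot occur for infinite words)
LexLt : {A : Set a} → (A → A → Set ℓ) → (ℕ → A) → (ℕ → A) → Set (a Level.⊔ ℓ)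
LexLt _≺_ s t = ∃ λ n → (∀ i → i < n → s i ≡ t i) × (s n ≺ t n)

IsFractionalPower : {A : Set a} → List A → List A → Set a
IsFractionalPower v u =
  Σ _ λ u₁ → Σ _ λ u₂ → Σ ℕ λ k → (u ≡ u₁ ++ u₂) × (v ≡ (u ^ k) ++ u₁)

-- Two infinite words beginning with incomparable finite words q and r are
-- compared at the first position where q and r differ, so their order depends
-- only on q and r. For (i) take q = u and r = v. For (ii) take q = u^(k+1) and
-- r = v: u^(k+1) is not a prefix of v by maximality of k, and v is not a prefix
-- of u^(k+1), since otherwise v = u^k u₁ with u₁ a prefix of u.
module Submission where

open import Defs
open import Level using (Level)
open import Data.Nat using (ℕ; zero; suc; _+_; _<_; s≤s; z≤n)
open import Data.Nat.Properties using (+-comm)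
open import Data.Nat.DivMod using (_%_; m<n⇒m%n≡m; [m+n]%n≡m%n)
open import Data.Fin using (fromℕ<)
open import Data.Fin.Properties using (fromℕ<-cong)
open import Data.List using (List; []; _∷_; _++_; length; lookup)
open import Data.List.Properties using (++-assoc; ++-identityʳ; ++-cancelˡ)
open import Data.List.NonEmpty using (List⁺; _∷_; toList; _⁺++_)
open import Data.Product using (_×_; _,_)
open import Data.Sum using (_⊎_; inj₁; inj₂)
open import Data.Empty using (⊥-elim)
open import Relation.Nullary using (¬_)
open import Relation.Binary.Core using (Rel)
open import Relation.Binary.Structures using (IsStrictTotalOrder)
open import Relation.Binary.PropositionalEquality
  using (_≡_; refl; sym; trans; cong; cong₂; subst₂; module ≡-Reasoning)

private variable a ℓ : Level

tailω : {A : Set a} → (ℕ → A) → ℕ → A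
tailω s i = s (suc i)

dropω : {A : Set a} → ℕ → (ℕ → A) → ℕ → A
dropω n s i = s (n + i)

data IsPrefixω {A : Set a} : List A → (ℕ → A) → Set a where
  []  : ∀ {s} → IsPrefixω [] s
  _∷_ : ∀ {c q s} → s 0 ≡ c → IsPrefixω q (tailω s) → IsPrefixω (c ∷ q) s

module _ {A : Set a} where

  IsPrefixω-trans : {p q : List A} {s : ℕ → A} →
    IsPrefix p q → IsPrefixω q s → IsPrefixω p s
  IsPrefixω-trans {[]}    _          _          = []
  IsPrefixω-trans {c ∷ p} (w , refl) (e ∷ h) = e ∷ IsPrefixω-trans (w , refl) h

  IsPrefixω-++⁺ : {q r : List A} {s : ℕ → A} →
    IsPrefixω q s → IsPrefixω r (dropω (length q) s) → IsPrefixω (q ++ r) s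
  IsPrefixω-++⁺ []      h = h
  IsPrefixω-++⁺ (e ∷ g) h = e ∷ IsPrefixω-++⁺ g h

  IsPrefixω-cong : {q : List A} {s t : ℕ → A} →
    (∀ i → s i ≡ t i) → IsPrefixω q s → IsPrefixω q t
  IsPrefixω-cong s≗t []      = []
  IsPrefixω-cong s≗t (e ∷ h) = trans (sym (s≗t 0)) e ∷ IsPrefixω-cong (λ i → s≗t (suc i)) h

  IsPrefixω-lookup : (q : List A) {s : ℕ → A} →
    (∀ i (i<n : i < length q) → s i ≡ lookup q (fromℕ< i<n)) → IsPrefixω q s
  IsPrefixω-lookup []      _ = []
  IsPrefixω-lookup (c ∷ q) f = f 0 (s≤s z≤n) ∷ IsPrefixω-lookup q (λ i i<n → f (suc i) (s≤s i<n))

  IsPrefixω-^ : {q : List A} {s : ℕ → A} →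
    (∀ i → dropω (length q) s i ≡ s i) → IsPrefixω q s → (k : ℕ) → IsPrefixω (q ^ k) s
  IsPrefixω-^ periodic h zero    = []
  IsPrefixω-^ periodic h (suc k) =
    IsPrefixω-++⁺ h (IsPrefixω-cong (λ i → sym (periodic i)) (IsPrefixω-^ periodic h k))

  ^ω-IsPrefixω : (w : List⁺ A) → IsPrefixω (toList w) (w ^ω)
  ^ω-IsPrefixω w = IsPrefixω-lookup (toList w) λ i i<n →
    cong (lookup (toList w)) (fromℕ<-cong _ _ (m<n⇒m%n≡m i<n) _ i<n)

  ^ω-periodic : (w : List⁺ A) (i : ℕ) → dropω (length (toList w)) (w ^ω) i ≡ (w ^ω) i
  ^ω-periodic w i = cong (lookup (toList w)) (fromℕ<-cong _ _ n+i%n≡i%n _ _)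
    where
    n = length (toList w)
    n+i%n≡i%n : (n + i) % n ≡ i % n
    n+i%n≡i%n = trans (cong (_% n) (+-comm n i)) ([m+n]%n≡m%n i n)

  ^ω-IsPrefixω-^ : (w : List⁺ A) (k : ℕ) → IsPrefixω (toList w ^ k) (w ^ω)
  ^ω-IsPrefixω-^ w = IsPrefixω-^ (^ω-periodic w) (^ω-IsPrefixω w)

  ⁺++-^ω-IsPrefixω : (w : List⁺ A) (z : List A) → IsPrefixω (toList w ++ z) ((w ⁺++ z) ^ω)
  ⁺++-^ω-IsPrefixω (c ∷ cs) z = ^ω-IsPrefixω (c ∷ (cs ++ z))

  ^-++-comm : (w : List A) (k : ℕ) → (w ^ k) ++ w ≡ w ++ (w ^ k)
  ^-++-comm w zero    = sym (++-identityʳ w)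
  ^-++-comm w (suc k) = trans (++-assoc w (w ^ k) w) (cong (w ++_) (^-++-comm w k))

  prefix-of-^-suc⇒IsFractionalPower : (u v : List A) (k : ℕ) →
    IsPrefix (u ^ k) v → IsPrefix v (u ^ suc k) → IsFractionalPower v u
  prefix-of-^-suc⇒IsFractionalPower u v k (u₁ , uᵏu₁≡v) (u₂ , vu₂≡uᵏ⁺¹) =
    u₁ , u₂ , k , sym (++-cancelˡ (u ^ k) (u₁ ++ u₂) u uᵏu₁u₂≡uᵏu) , sym uᵏu₁≡v
    where
    open ≡-Reasoning
    uᵏu₁u₂≡uᵏu : (u ^ k) ++ (u₁ ++ u₂) ≡ (u ^ k) ++ u
    uᵏu₁u₂≡uᵏu = begin
      (u ^ k) ++ (u₁ ++ u₂) ≡⟨ ++-assoc (u ^ k) u₁ u₂ ⟨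
      ((u ^ k) ++ u₁) ++ u₂ ≡⟨ cong (_++ u₂) uᵏu₁≡v ⟩
      v ++ u₂               ≡⟨ vu₂≡uᵏ⁺¹ ⟩
      u ++ (u ^ k)          ≡⟨ ^-++-comm u k ⟨
      (u ^ k) ++ u          ∎

module _ {A : Set a} (_≺_ : Rel A ℓ) where

  LexLt-here : {s t : ℕ → A} → s 0 ≺ t 0 → LexLt _≺_ s t
  LexLt-here s0≺t0 = 0 , (λ _ ()) , s0≺t0

  LexLt-there : {s t : ℕ → A} → s 0 ≡ t 0 → LexLt _≺_ (tailω s) (tailω t) → LexLt _≺_ s t
  LexLt-there s0≡t0 (n , agree , lt) =
    suc n , (λ { zero _ → s0≡t0 ; (suc i) (s≤s i<n) → agree i i<n }) , lt

  LexLt-uncons : {s t : ℕ → A} → LexLt _≺_ s t →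
    s 0 ≺ t 0 ⊎ (s 0 ≡ t 0 × LexLt _≺_ (tailω s) (tailω t))
  LexLt-uncons (zero  , agree , lt) = inj₁ lt
  LexLt-uncons (suc n , agree , lt) =
    inj₂ (agree 0 (s≤s z≤n) , n , (λ i i<n → agree (suc i) (s≤s i<n)) , lt)

  -- No property of _≺_ is needed: s and t cannot differ before q and r do.
  LexLt-by-incomparable-prefixes : (q r : List A) {s t s′ t′ : ℕ → A} →
    ¬ IsPrefix q r → ¬ IsPrefix r q →
    IsPrefixω q s → IsPrefixω r t → LexLt _≺_ s t →
    IsPrefixω q s′ → IsPrefixω r t′ → LexLt _≺_ s′ t′
  LexLt-by-incomparable-prefixes [] r q⋢r _ = ⊥-elim (q⋢r (r , refl))
  LexLt-by-incomparable-prefixes (c ∷ q) [] _ r⋢q = ⊥-elim (r⋢q (c ∷ q , refl))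
  LexLt-by-incomparable-prefixes (c ∷ q) (d ∷ r) q⋢r r⋢q
    (s0≡c ∷ qs) (t0≡d ∷ rt) s<t (s′0≡c ∷ qs′) (t′0≡d ∷ rt′) with LexLt-uncons s<t
  ... | inj₁ s0≺t0 =
    LexLt-here (subst₂ _≺_ (trans s0≡c (sym s′0≡c)) (trans t0≡d (sym t′0≡d)) s0≺t0)
  ... | inj₂ (s0≡t0 , tails<) =
    LexLt-there (trans s′0≡c (trans c≡d (sym t′0≡d)))
      (LexLt-by-incomparable-prefixes q r
        (λ (w , e) → q⋢r (w , cong₂ _∷_ c≡d e)) (λ (w , e) → r⋢q (w , cong₂ _∷_ (sym c≡d) e))
        qs rt tails< qs′ rt′)
    where
    c≡d : c ≡ d
    c≡d = trans (sym s0≡c) (trans s0≡t0 t0≡d)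

lemma4 : {a ℓ : Level} (A : Set a) (_≺_ : Rel A ℓ) → IsStrictTotalOrder _≡_ _≺_ →
    (u v : List⁺ A) (x y : List A) →
    LexLt _≺_ (u ^ω) (v ^ω) →
    ((¬ IsPrefix (toList u) (toList v) → ¬ IsPrefix (toList v) (toList u) →
        LexLt _≺_ ((u ⁺++ x) ^ω) ((v ⁺++ y) ^ω))
    × (¬ IsFractionalPower (toList v) (toList u) →
        (k : ℕ) → IsPrefix (toList u ^ k) (toList v) →
        ¬ IsPrefix (toList u ^ suc k) (toList v) →
        LexLt _≺_ ((u ⁺++ ((toList u ^ k) ++ x)) ^ω) ((v ⁺++ y) ^ω)
        × LexLt _≺_ (u ^ω) ((v ⁺++ y) ^ω)))
lemma4 A _≺_ _ u v x y u^ω<v^ω =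
  (λ u⋢v v⋢u → against (toList u) u⋢v v⋢u (^ω-IsPrefixω u)
                 (IsPrefixω-trans (x , refl) (⁺++-^ω-IsPrefixω u x)))
  , λ not-fractional k uᵏ⊑v uᵏ⁺¹⋢v →
    let uᵏ⁺¹ = toList u ^ suc k
        v⋢uᵏ⁺¹ = λ v⊑uᵏ⁺¹ → not-fractional
          (prefix-of-^-suc⇒IsFractionalPower (toList u) (toList v) k uᵏ⊑v v⊑uᵏ⁺¹)
        against-uᵏ⁺¹ = against uᵏ⁺¹ uᵏ⁺¹⋢v v⋢uᵏ⁺¹ (^ω-IsPrefixω-^ u (suc k))
    in against-uᵏ⁺¹ (IsPrefixω-trans (x , ++-assoc (toList u) (toList u ^ k) x)
                                     (⁺++-^ω-IsPrefixω u ((toList u ^ k) ++ x)))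
     , against-uᵏ⁺¹ (^ω-IsPrefixω-^ u (suc k))
  where
  against : (q : List A) → ¬ IsPrefix q (toList v) → ¬ IsPrefix (toList v) q →
    IsPrefixω q (u ^ω) → {s : ℕ → A} → IsPrefixω q s → LexLt _≺_ s ((v ⁺++ y) ^ω)
  against q q⋢v v⋢q q⊑u^ω q⊑s = LexLt-by-incomparable-prefixes _≺_ q (toList v) q⋢v v⋢q
    q⊑u^ω (^ω-IsPrefixω v) u^ω<v^ω q⊑s (IsPrefixω-trans (y , refl) (⁺++-^ω-IsPrefixω v y))
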